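{- Let $p$ be a prime and $m\geq 3$ an integer with $\gcd(p,m)=1$ and $\gcd(p-1,m)=1$. Let $\ell=\min\{e\geq 1:\gcd(p^e-1,m)>1\}$, $L=\mathbb{F}_{p^\ell}$, $m'=\gcd(p^\ell-1,m)$, $H$ the group of $m'$th roots of unity in $L$, and $T=\mathrm{tr}_{L/\mathbb{F}_p}(H)\subseteq\mathbb{F}_p$. Then $|T|\geq 2$.
   Context: $\mathrm{tr}_{L/\mathbb{F}_p}$ denotes the field trace from $L$ to $\mathbb{F}_p$. -}

module Defs where

open import Level using (Level; _⊔_)
open import Data.Nat using (ℕ; zero; suc; _^_)
open import Data.Fin using (Fin)
open import Data.Product using (∃; _×_)
open import Relation.Nullary using (¬_)
open import Algebra.Bundles using (CommutativeRing)
open import Function.Bundles using (Inverse)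
import Relation.Binary.PropositionalEquality as ≡

module _ {c ℓ : Level} (R : CommutativeRing c ℓ) where
  open CommutativeRing R

  IsField : Set (c ⊔ ℓ)
  IsField = (¬ (1# ≈ 0#)) × (∀ x → ¬ (x ≈ 0#) → ∃ λ y → (x * y) ≈ 1#)

  HasSize : ℕ → Set (c ⊔ ℓ)
  HasSize q = Inverse setoid (≡.setoid (Fin q))

  pow : Carrier → ℕ → Carrier
  pow x zero    = 1#
  pow x (suc n) = x * pow x n

  trace : ℕ → ℕ → Carrier → Carrier
  trace p zero    x = 0#
  trace p (suc k) x = pow x (p ^ k) + trace p k x

{-# OPTIONS --safe #-}
module Submission where

open import Defs
open import Level using (Level)
open import Data.Nat using (ℕ; _≤_; _<_; _^_; _∸_)
open import Data.Nat.GCD using (gcd)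
open import Data.Nat.Primality using (Prime)
open import Data.Product using (∃₂; _×_)
open import Relation.Nullary using (¬_)
open import Relation.Binary.PropositionalEquality using (_≡_)
open import Algebra.Bundles using (CommutativeRing)

import Algebra.Properties.CommutativeMonoid.Sum
import Algebra.Properties.CommutativeSemiring.Exp
import Algebra.Properties.Ring
import Algebra.Properties.Semiring.Sum
import Algebra.Solver.Ring.NaturalCoefficients
open import Data.Fin using (Fin; zero; suc; punchIn; _≟_)
open import Data.Fin.Permutation using (Permutation; _⟨$⟩ʳ_; remove; punchIn-permute)
open import Data.Fin.Properties using (all?; ¬∀⟶∃¬; suc-injective; 0≢1+n; punchIn-injective; punchInᵢ≢i)
open import Data.List using (List; []; _∷_; length; replicate)
open import Data.List.Properties using (length-replicate)
open import Data.Maybe using (nothing)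
import Data.Nat as ℕ
open import Data.Nat using (zero; suc; pred; NonZero; >-nonZero; ≢-nonZero; nonTrivial⇒n>1; z≤n; s≤s)
open import Data.Nat.Divisibility using (_∣_; _∤_; _∣0; ∣-refl; ∣⇒≤; >⇒∤; ∣m+n∣m⇒∣n; *-cancelˡ-∣; m%n≡0⇒n∣m)
open import Data.Nat.DivMod using (_%_; _/_; m%n<n; m≡m%n+[m/n]*n)
open import Data.Nat.GCD using (gcd[m,n]∣m; gcd[m,n]∣n; gcd-greatest; gcd[m,n]≢0)
open import Data.Nat.Primality using (prime⇒nonTrivial)
import Data.Nat.Properties as ℕ
open import Data.Product using (∃; _,_; proj₁; proj₂)
open import Data.Sum using (_⊎_; inj₁; inj₂)
open import Data.Vec.Functional using (Vector; tail)
open import Function using (_∘_; id; Inverse; Congruent)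
import Function.Construct.Composition as Composition
import Function.Construct.Symmetry as Symmetry
open import Relation.Binary using (Decidable)
open import Relation.Binary.PropositionalEquality as ≡ using (subst; cong)
import Relation.Binary.Reasoning.Setoid
open import Relation.Nullary using (Dec; yes; no; contradiction)
open import Relation.Nullary.Decidable using (_⊎-dec_)

-- Write p ^ ℓ = N + 1 with N = k m′, put E = k (m′ − 1) and S(e) = Σ_{x ∈ L} x ^ e.
-- If N ∤ e then S(e) = 0: with r = e mod N, X ^ r − 1 has at most r < N roots, so some a ≠ 0 has
-- a ^ e = a ^ r ≠ 1, while S(e) = a ^ e S(e) by substituting a x for x. By Fermat and Σ_x 1 = 0, S(N) = −1.
-- Expanding the trace, Σ_x x ^ E tr(x ^ k) = Σ_{i<ℓ} S(E + k p ^ i) = S(N) = −1, as the minimality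
-- of ℓ gives N ∤ E + k p ^ i for 0 < i < ℓ. Were tr(x ^ k) = tr(1) for every x ≠ 0, the same sum
-- would be tr(1) S(E) = 0. So some x ≠ 0 has tr(x ^ k) ≠ tr(1), and x ^ k and 1 are m′-th roots of unity.

m∣pred[m]+n⇒m∣pred[n] : ∀ {m} n → .{{NonZero m}} → m ∣ pred m ℕ.+ n → m ∣ pred n
m∣pred[m]+n⇒m∣pred[n]         zero    _   = _ ∣0
m∣pred[m]+n⇒m∣pred[n] {suc m} (suc n) m∣ = ∣m+n∣m⇒∣n (subst (suc m ∣_) (ℕ.+-suc m n) m∣) ∣-refl

k*m∣k*pred[m]+k*n⇒m∣pred[n] : ∀ k {m} n .{{_ : NonZero k}} .{{_ : NonZero m}} →
                              k ℕ.* m ∣ k ℕ.* pred m ℕ.+ k ℕ.* n → m ∣ pred n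
k*m∣k*pred[m]+k*n⇒m∣pred[n] k {m} n k*m∣ =
  m∣pred[m]+n⇒m∣pred[n] n (*-cancelˡ-∣ k (subst (k ℕ.* m ∣_) (≡.sym (ℕ.*-distribˡ-+ k (pred m) n)) k*m∣))

k*m∤k*pred[m] : ∀ k {m} .{{_ : NonZero k}} → 1 < m → k ℕ.* m ∤ k ℕ.* pred m
k*m∤k*pred[m] k {suc (suc m)} (s≤s (s≤s z≤n)) = >⇒∤ (ℕ.n<1+n (suc m)) ∘ *-cancelˡ-∣ k

k*pred[m]+k≡k*m : ∀ k m .{{_ : NonZero m}} → k ℕ.* pred m ℕ.+ k ≡ k ℕ.* m
k*pred[m]+k≡k*m k (suc m) = ≡.trans (ℕ.+-comm (k ℕ.* m) k) (≡.sym (ℕ.*-suc k m))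

below-order⇒∤pred[p^j] : ∀ {p m d ℓ} .{{_ : NonZero m}} → d ∣ m → 1 < d →
                         (∀ j → 1 ≤ j → j < ℓ → ¬ (1 < gcd (p ^ j ∸ 1) m)) →
                         ∀ j → 1 ≤ j → j < ℓ → d ∤ pred (p ^ j)
below-order⇒∤pred[p^j] {p} {m} d∣m 1<d below-order j 1≤j j<ℓ d∣ =
  below-order j 1≤j j<ℓ (ℕ.<-≤-trans 1<d (∣⇒≤ {{gcd≢0}} (gcd-greatest d∣ d∣m)))
  where
  gcd≢0 : NonZero (gcd (p ^ j ∸ 1) m)
  gcd≢0 = ≢-nonZero (gcd[m,n]≢0 (p ^ j ∸ 1) m (inj₂ (ℕ.≢-nonZero⁻¹ m)))

module FieldProperties {c ℓ′ : Level} (L : CommutativeRing c ℓ′) (isField : IsField L) where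

  open CommutativeRing L hiding (zero)
  open Algebra.Properties.Ring ring using (x∙y⁻¹≈ε⇒x≈y; x≈y⇒x∙y⁻¹≈ε; [y-z]x≈yx-zx; -0#≈0#; -‿involutive)
  open Algebra.Properties.CommutativeSemiring.Exp commutativeSemiring public
    renaming (_^_ to infixr 8 _^ᴸ_)
  open Algebra.Properties.CommutativeMonoid.Sum *-commutativeMonoid public
    using () renaming (sum to ∏)
  open Relation.Binary.Reasoning.Setoid setoid
  open Algebra.Solver.Ring.NaturalCoefficients commutativeSemiring (λ _ _ → nothing)

  pow≡^ᴸ : ∀ x n → pow L x n ≡ x ^ᴸ n
  pow≡^ᴸ x zero    = ≡.refl
  pow≡^ᴸ x (suc n) = cong (x *_) (pow≡^ᴸ x n)

  1^ᴸn≈1 : ∀ n → 1# ^ᴸ n ≈ 1#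
  1^ᴸn≈1 zero    = refl
  1^ᴸn≈1 (suc n) = trans (*-identityˡ _) (1^ᴸn≈1 n)

  0^ᴸn≈0 : ∀ n → .{{NonZero n}} → 0# ^ᴸ n ≈ 0#
  0^ᴸn≈0 (suc n) = zeroˡ (0# ^ᴸ n)

  1≉0 : 1# ≉ 0#
  1≉0 = proj₁ isField

  -1≉0 : - 1# ≉ 0#
  -1≉0 -1≈0 = 1≉0 (trans (sym (-‿involutive 1#)) (trans (-‿cong -1≈0) -0#≈0#))

  x*y≈0⇒y≈0 : ∀ {x y} → x ≉ 0# → x * y ≈ 0# → y ≈ 0#
  x*y≈0⇒y≈0 {x} {y} x≉0 xy≈0 = let x⁻¹ , xx⁻¹≈1 = proj₂ isField x x≉0 in begin
    y              ≈⟨ sym (*-identityˡ y) ⟩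
    1# * y         ≈⟨ *-congʳ (sym xx⁻¹≈1) ⟩
    (x * x⁻¹) * y  ≈⟨ solve 3 (λ x x⁻¹ y → (x :* x⁻¹) :* y := x⁻¹ :* (x :* y)) refl x x⁻¹ y ⟩
    x⁻¹ * (x * y)  ≈⟨ *-congˡ xy≈0 ⟩
    x⁻¹ * 0#       ≈⟨ zeroʳ x⁻¹ ⟩
    0#             ∎

  x-y≉0 : ∀ {x y} → x ≉ y → x - y ≉ 0#
  x-y≉0 {x} {y} x≉y = x≉y ∘ x∙y⁻¹≈ε⇒x≈y x y

  *-cancelʳ-≉0 : ∀ {x y z} → z ≉ 0# → x * z ≈ y * z → x ≈ y
  *-cancelʳ-≉0 {x} {y} {z} z≉0 xz≈yz = x∙y⁻¹≈ε⇒x≈y x y (x*y≈0⇒y≈0 z≉0 (begin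
    z * (x - y)    ≈⟨ *-comm z (x - y) ⟩
    (x - y) * z    ≈⟨ [y-z]x≈yx-zx z x y ⟩
    x * z - y * z  ≈⟨ x≈y⇒x∙y⁻¹≈ε xz≈yz ⟩
    0#             ∎))

  x*y≈y⇒y≈0 : ∀ {x y} → x ≉ 1# → x * y ≈ y → y ≈ 0#
  x*y≈y⇒y≈0 {x} {y} x≉1 xy≈y = x*y≈0⇒y≈0 (x-y≉0 x≉1) (begin
    (x - 1#) * y    ≈⟨ [y-z]x≈yx-zx y x 1# ⟩
    x * y - 1# * y  ≈⟨ x≈y⇒x∙y⁻¹≈ε (trans xy≈y (sym (*-identityˡ y))) ⟩
    0#              ∎)

  ∏-≉0 : ∀ {n} (f : Vector Carrier n) → (∀ i → f i ≉ 0#) → ∏ f ≉ 0#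
  ∏-≉0 {zero}  f f≉0 = 1≉0
  ∏-≉0 {suc n} f f≉0 = ∏-≉0 (tail f) (f≉0 ∘ suc) ∘ x*y≈0⇒y≈0 (f≉0 zero)

module MonicPolynomial {c ℓ′ : Level} (L : CommutativeRing c ℓ′) (isField : IsField L) where

  open CommutativeRing L hiding (zero)
  open FieldProperties L isField
  open Algebra.Properties.Ring ring using (//-rightDividesˡ)
  open Relation.Binary.Reasoning.Setoid setoid
  open Algebra.Solver.Ring.NaturalCoefficients commutativeSemiring (λ _ _ → nothing)

  -- A monic polynomial is given by its coefficients below the leading 1, lowest degree first.
  evalMonic : List Carrier → Carrier → Carrier
  evalMonic []       x = 1#
  evalMonic (c ∷ cs) x = c + x * evalMonic cs x

  quotient : List Carrier → Carrier → List Carrier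
  quotient []           a = []
  quotient (_ ∷ [])     a = []
  quotient (_ ∷ c ∷ cs) a = evalMonic (c ∷ cs) a ∷ quotient (c ∷ cs) a

  length-quotient : ∀ c cs a → length (quotient (c ∷ cs) a) ≡ length cs
  length-quotient c []        a = ≡.refl
  length-quotient c (c′ ∷ cs) a = cong suc (length-quotient c′ cs a)

  -- With d = x - a treated as an atom and x rewritten as d + a, each step is a semiring identity.
  evalMonic-division : ∀ c cs x a →
    evalMonic (c ∷ cs) x ≈ (x - a) * evalMonic (quotient (c ∷ cs) a) x + evalMonic (c ∷ cs) a
  evalMonic-division c []        x a = begin
    c + x * 1#                   ≈⟨ +-congˡ (*-congʳ x≈d+a) ⟩
    c + (d + a) * 1#             ≈⟨ solve 3 (λ c d a → c :+ (d :+ a) :* con 1 := d :* con 1 :+ (c :+ a :* con 1)) refl c d a ⟩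
    d * 1# + (c + a * 1#)        ∎
    where
    d = x - a
    x≈d+a : x ≈ d + a
    x≈d+a = sym (//-rightDividesˡ a x)
  evalMonic-division c (c′ ∷ cs) x a = begin
    c + x * evalMonic (c′ ∷ cs) x        ≈⟨ +-congˡ (*-cong x≈d+a (evalMonic-division c′ cs x a)) ⟩
    c + (d + a) * (d * q + r)            ≈⟨ solve 5 (λ c d a q r → c :+ (d :+ a) :* (d :* q :+ r) := d :* (r :+ (d :+ a) :* q) :+ (c :+ a :* r)) refl c d a q r ⟩
    d * (r + (d + a) * q) + (c + a * r)  ≈⟨ +-congʳ (*-congˡ (+-congˡ (*-congʳ (sym x≈d+a)))) ⟩
    d * (r + x * q) + (c + a * r)        ∎
    where
    d = x - a
    q = evalMonic (quotient (c′ ∷ cs) a) x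
    r = evalMonic (c′ ∷ cs) a
    x≈d+a : x ≈ d + a
    x≈d+a = sym (//-rightDividesˡ a x)

  roots≤degree : ∀ {n} (cs : List Carrier) (xs : Vector Carrier n) →
                 (∀ {i j} → xs i ≈ xs j → i ≡ j) → (∀ i → evalMonic cs (xs i) ≈ 0#) → n ≤ length cs
  roots≤degree {zero}  cs       xs injective roots = z≤n
  roots≤degree {suc n} []       xs injective roots = contradiction (roots zero) 1≉0
  roots≤degree {suc n} (c ∷ cs) xs injective roots =
    s≤s (subst (n ≤_) (length-quotient c cs a)
      (roots≤degree (quotient (c ∷ cs) a) (tail xs) (suc-injective ∘ injective) quotient-roots))
    where
    a = xs zero
    quotient-roots : ∀ i → evalMonic (quotient (c ∷ cs) a) (xs (suc i)) ≈ 0#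
    quotient-roots i = x*y≈0⇒y≈0 (x-y≉0 (0≢1+n ∘ ≡.sym ∘ injective)) (begin
      (x - a) * Q                       ≈⟨ sym (+-identityʳ _) ⟩
      (x - a) * Q + 0#                  ≈⟨ +-congˡ (sym (roots zero)) ⟩
      (x - a) * Q + evalMonic (c ∷ cs) a  ≈⟨ sym (evalMonic-division c cs x a) ⟩
      evalMonic (c ∷ cs) x              ≈⟨ roots (suc i) ⟩
      0#                                ∎)
      where
      x = xs (suc i)
      Q = evalMonic (quotient (c ∷ cs) a) x

  X^[1+_]-1 : ℕ → List Carrier
  X^[1+ r ]-1 = - 1# ∷ replicate r 0#

  evalMonic-X^[1+r]-1 : ∀ r x → evalMonic X^[1+ r ]-1 x ≈ - 1# + x ^ᴸ suc r
  evalMonic-X^[1+r]-1 r x = +-congˡ (*-congˡ (evalMonic-zeros r))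
    where
    evalMonic-zeros : ∀ r → evalMonic (replicate r 0#) x ≈ x ^ᴸ r
    evalMonic-zeros zero    = refl
    evalMonic-zeros (suc r) = trans (+-identityˡ _) (*-congˡ (evalMonic-zeros r))

module FiniteField {c ℓ′ : Level} (L : CommutativeRing c ℓ′) (isField : IsField L)
                   {N : ℕ} .{{_ : NonZero N}} (size : HasSize L (suc N)) where

  open CommutativeRing L hiding (zero)
  open FieldProperties L isField
  open MonicPolynomial L isField
  open Inverse size
  open Algebra.Properties.Ring ring using (//-rightDividesˡ; //-rightDividesʳ; +-identityʳ-unique; +-inverseʳ-unique)
  open Algebra.Properties.Semiring.Sum semiring using (sum; sum-remove; ∑-permute; ∑-distrib-+; sum-cong-≋; *-distribˡ-sum)
  module Π = Algebra.Properties.CommutativeMonoid.Sum *-commutativeMonoid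
  open Relation.Binary.Reasoning.Setoid setoid

  from-to : ∀ x → from (to x) ≈ x
  from-to x = inverseʳ ≡.refl

  to-from : ∀ i → to (from i) ≡ i
  to-from i = inverseˡ refl

  infix 4 _≈?_
  _≈?_ : Decidable _≈_
  x ≈? y with to x ≟ to y
  ... | yes tx≡ty = yes (trans (sym (from-to x)) (trans (from-cong tx≡ty) (from-to y)))
  ... | no  tx≢ty = no (tx≢ty ∘ to-cong)

  0ᶠ : Fin (suc N)
  0ᶠ = to 0#

  from≈0⇒≡0ᶠ : ∀ {i} → from i ≈ 0# → i ≡ 0ᶠ
  from≈0⇒≡0ᶠ {i} from-i≈0 = ≡.trans (≡.sym (to-from i)) (to-cong from-i≈0)

  unit : Fin N → Carrier
  unit i = from (punchIn 0ᶠ i)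

  unit≉0 : ∀ i → unit i ≉ 0#
  unit≉0 i = punchInᵢ≢i 0ᶠ i ∘ from≈0⇒≡0ᶠ

  unit-injective : ∀ {i j} → unit i ≈ unit j → i ≡ j
  unit-injective {i} {j} ui≈uj =
    punchIn-injective 0ᶠ i j (≡.trans (≡.sym (to-from _)) (≡.trans (to-cong ui≈uj) (to-from _)))

  ∑ : (Carrier → Carrier) → Carrier
  ∑ f = sum (f ∘ from)

  relabel : Inverse setoid setoid → Permutation (suc N) (suc N)
  relabel σ = Composition.inverse (Symmetry.inverse size) (Composition.inverse σ size)

  ∑-relabel : ∀ (σ : Inverse setoid setoid) {f} → Congruent _≈_ _≈_ f → ∑ (f ∘ Inverse.to σ) ≈ ∑ f
  ∑-relabel σ {f} f-cong = sym (begin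
    ∑ f                                      ≈⟨ ∑-permute (f ∘ from) (relabel σ) ⟩
    sum (f ∘ from ∘ to ∘ Inverse.to σ ∘ from)  ≈⟨ sum-cong-≋ (f-cong ∘ from-to ∘ Inverse.to σ ∘ from) ⟩
    ∑ (f ∘ Inverse.to σ)                     ∎)

  translation : Carrier → Inverse setoid setoid
  translation a = record
    { to        = _+ a
    ; from      = _- a
    ; to-cong   = +-congʳ
    ; from-cong = +-congʳ
    ; inverse   = (λ y≈x-a → trans (+-congʳ y≈x-a) (//-rightDividesˡ a _))
                , (λ y≈x+a → trans (+-congʳ y≈x+a) (//-rightDividesʳ a _))
    }

  dilation : ∀ {a} → a ≉ 0# → Inverse setoid setoid
  dilation {a} a≉0 = let a⁻¹ , aa⁻¹≈1 = proj₂ isField a a≉0 in record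
    { to        = a *_
    ; from      = a⁻¹ *_
    ; to-cong   = *-congˡ
    ; from-cong = *-congˡ
    ; inverse   = (λ y≈a⁻¹x → trans (*-congˡ y≈a⁻¹x) (cancel aa⁻¹≈1 _))
                , (λ y≈ax → trans (*-congˡ y≈ax) (cancel (trans (*-comm a⁻¹ a) aa⁻¹≈1) _))
    }
    where
    cancel : ∀ {u v} → u * v ≈ 1# → ∀ x → u * (v * x) ≈ x
    cancel {u} {v} uv≈1 x = trans (sym (*-assoc u v x)) (trans (*-congʳ uv≈1) (*-identityˡ x))

  ∑1≈0 : ∑ (λ _ → 1#) ≈ 0#
  ∑1≈0 = +-identityʳ-unique (∑ id) (∑ (λ _ → 1#)) (begin
    ∑ id + ∑ (λ _ → 1#)  ≈⟨ sym (∑-distrib-+ from (λ _ → 1#)) ⟩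
    ∑ (_+ 1#)            ≈⟨ ∑-relabel (translation 1#) id ⟩
    ∑ id                 ∎)

  fermat : ∀ {a} → a ≉ 0# → a ^ᴸ N ≈ 1#
  fermat {a} a≉0 = *-cancelʳ-≉0 (∏-≉0 unit unit≉0) (begin
    a ^ᴸ N * ∏ unit           ≈⟨ *-congʳ (sym (Π.sum-replicate N)) ⟩
    ∏ {N} (λ _ → a) * ∏ unit  ≈⟨ sym (Π.∑-distrib-+ (λ _ → a) unit) ⟩
    ∏ (λ i → a * unit i)      ≈⟨ Π.sum-cong-≋ a*unit≈unit∘σ ⟩
    ∏ (unit ∘ (σ ⟨$⟩ʳ_))      ≈⟨ sym (Π.∑-permute unit σ) ⟩
    ∏ unit                    ≈⟨ sym (*-identityˡ _) ⟩
    1# * ∏ unit               ∎)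
    where
    π : Permutation (suc N) (suc N)
    π = relabel (dilation a≉0)
    σ : Permutation N N
    σ = remove 0ᶠ π
    π0ᶠ≡0ᶠ : π ⟨$⟩ʳ 0ᶠ ≡ 0ᶠ
    π0ᶠ≡0ᶠ = to-cong (trans (*-congˡ (from-to 0#)) (zeroʳ a))
    a*unit≈unit∘σ : ∀ i → a * unit i ≈ unit (σ ⟨$⟩ʳ i)
    a*unit≈unit∘σ i = begin
      a * unit i                             ≈⟨ sym (from-to _) ⟩
      from (π ⟨$⟩ʳ punchIn 0ᶠ i)             ≡⟨ cong from (punchIn-permute π 0ᶠ i) ⟩
      from (punchIn (π ⟨$⟩ʳ 0ᶠ) (σ ⟨$⟩ʳ i))  ≡⟨ cong (λ j → from (punchIn j (σ ⟨$⟩ʳ i))) π0ᶠ≡0ᶠ ⟩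
      unit (σ ⟨$⟩ʳ i)                        ∎

  x^e≈x^[e%N] : ∀ {x} e → x ≉ 0# → x ^ᴸ e ≈ x ^ᴸ (e % N)
  x^e≈x^[e%N] {x} e x≉0 = begin
    x ^ᴸ e                               ≡⟨ cong (x ^ᴸ_) (m≡m%n+[m/n]*n e N) ⟩
    x ^ᴸ (e % N ℕ.+ e / N ℕ.* N)         ≈⟨ ^-homo-* x (e % N) _ ⟩
    x ^ᴸ (e % N) * x ^ᴸ (e / N ℕ.* N)    ≡⟨ cong (λ n → x ^ᴸ (e % N) * x ^ᴸ n) (ℕ.*-comm (e / N) N) ⟩
    x ^ᴸ (e % N) * x ^ᴸ (N ℕ.* (e / N))  ≈⟨ *-congˡ (sym (^-assocʳ x N (e / N))) ⟩
    x ^ᴸ (e % N) * (x ^ᴸ N) ^ᴸ (e / N)   ≈⟨ *-congˡ (trans (^-congˡ (e / N) (fermat x≉0)) (1^ᴸn≈1 (e / N))) ⟩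
    x ^ᴸ (e % N) * 1#                    ≈⟨ *-identityʳ _ ⟩
    x ^ᴸ (e % N)                         ∎

  ∃x^[1+r]≉1 : ∀ r → suc r < N → ∃ λ x → x ≉ 0# × x ^ᴸ suc r ≉ 1#
  ∃x^[1+r]≉1 r 1+r<N with all? (λ i → unit i ^ᴸ suc r ≈? 1#)
  ... | yes all-roots = contradiction
    (subst (N ≤_) (cong suc (length-replicate r)) (roots≤degree X^[1+ r ]-1 unit unit-injective roots))
    (ℕ.<⇒≱ 1+r<N)
    where
    roots : ∀ i → evalMonic X^[1+ r ]-1 (unit i) ≈ 0#
    roots i = trans (evalMonic-X^[1+r]-1 r (unit i)) (trans (+-congˡ (all-roots i)) (-‿inverseˡ 1#))
  ... | no ¬all-roots =
    let i , ¬root = ¬∀⟶∃¬ N _ (λ i → unit i ^ᴸ suc r ≈? 1#) ¬all-roots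
    in unit i , unit≉0 i , ¬root

  ∑x^e≈0 : ∀ {e} → N ∤ e → ∑ (_^ᴸ e) ≈ 0#
  ∑x^e≈0 {e} N∤e with e % N in e%N≡
  ... | zero  = contradiction (m%n≡0⇒n∣m e N e%N≡) N∤e
  ... | suc r with ∃x^[1+r]≉1 r (subst (_< N) e%N≡ (m%n<n e N))
  ... | a , a≉0 , a^[1+r]≉1 = x*y≈y⇒y≈0 (a^[1+r]≉1 ∘ trans (sym a^e≈a^[1+r])) (begin
    a ^ᴸ e * ∑ (_^ᴸ e)         ≈⟨ *-distribˡ-sum (a ^ᴸ e) (λ i → from i ^ᴸ e) ⟩
    ∑ (λ x → a ^ᴸ e * x ^ᴸ e)  ≈⟨ sum-cong-≋ (λ i → sym (^-distrib-* a (from i) e)) ⟩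
    ∑ (λ x → (a * x) ^ᴸ e)     ≈⟨ ∑-relabel (dilation a≉0) (^-congˡ e) ⟩
    ∑ (_^ᴸ e)                  ∎)
    where
    a^e≈a^[1+r] : a ^ᴸ e ≈ a ^ᴸ suc r
    a^e≈a^[1+r] = trans (x^e≈x^[e%N] e a≉0) (^-congʳ a e%N≡)

  ∑x^N≈-1 : ∑ (_^ᴸ N) ≈ - 1#
  ∑x^N≈-1 = +-inverseʳ-unique 1# _ (begin
    1# + ∑ (_^ᴸ N)                                 ≈⟨ +-congˡ (sum-remove {i = 0ᶠ} (λ i → from i ^ᴸ N)) ⟩
    1# + (from 0ᶠ ^ᴸ N + sum (λ i → unit i ^ᴸ N))  ≈⟨ +-congˡ (+-cong from0ᶠ^N≈0 (sum-cong-≋ (fermat ∘ unit≉0))) ⟩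
    1# + (0# + sum {N} (λ _ → 1#))                 ≈⟨ +-congˡ (+-identityˡ _) ⟩
    1# + sum {N} (λ _ → 1#)                        ≡⟨⟩
    ∑ (λ _ → 1#)                                   ≈⟨ ∑1≈0 ⟩
    0#                                             ∎)
    where
    from0ᶠ^N≈0 : from 0ᶠ ^ᴸ N ≈ 0#
    from0ᶠ^N≈0 = trans (^-congˡ N (from-to 0#)) (0^ᴸn≈0 N)

module TraceOfPowers {c ℓ′ : Level} (L : CommutativeRing c ℓ′) (isField : IsField L)
                     {N : ℕ} .{{_ : NonZero N}} (size : HasSize L (suc N)) (p k E : ℕ) where

  open CommutativeRing L hiding (zero)
  open FieldProperties L isField
  open FiniteField L isField size
  open Inverse size using (from)
  open Algebra.Properties.Semiring.Sum semiring using (sum-cong-≋; ∑-distrib-+; *-distribˡ-sum; sum-replicate-zero)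
  open Relation.Binary.Reasoning.Setoid setoid

  traceMoment : ℕ → Carrier
  traceMoment j = ∑ (λ x → x ^ᴸ E * trace L p j (x ^ᴸ k))

  traceMoment-zero : traceMoment 0 ≈ 0#
  traceMoment-zero = trans (sum-cong-≋ (λ i → zeroʳ (from i ^ᴸ E))) (sum-replicate-zero (suc N))

  traceMoment-suc : ∀ j → traceMoment (suc j) ≈ ∑ (_^ᴸ (E ℕ.+ k ℕ.* p ^ j)) + traceMoment j
  traceMoment-suc j = trans (sum-cong-≋ (term ∘ from))
    (∑-distrib-+ (λ i → from i ^ᴸ (E ℕ.+ k ℕ.* p ^ j)) (λ i → from i ^ᴸ E * trace L p j (from i ^ᴸ k)))
    where
    term : ∀ x → x ^ᴸ E * trace L p (suc j) (x ^ᴸ k) ≈ x ^ᴸ (E ℕ.+ k ℕ.* p ^ j) + x ^ᴸ E * trace L p j (x ^ᴸ k)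
    term x = begin
      x ^ᴸ E * (pow L (x ^ᴸ k) (p ^ j) + T)     ≡⟨ cong (λ y → x ^ᴸ E * (y + T)) (pow≡^ᴸ (x ^ᴸ k) (p ^ j)) ⟩
      x ^ᴸ E * ((x ^ᴸ k) ^ᴸ p ^ j + T)          ≈⟨ distribˡ (x ^ᴸ E) _ T ⟩
      x ^ᴸ E * (x ^ᴸ k) ^ᴸ p ^ j + x ^ᴸ E * T   ≈⟨ +-congʳ (*-congˡ (^-assocʳ x k (p ^ j))) ⟩
      x ^ᴸ E * x ^ᴸ (k ℕ.* p ^ j) + x ^ᴸ E * T  ≈⟨ +-congʳ (sym (^-homo-* x E (k ℕ.* p ^ j))) ⟩
      x ^ᴸ (E ℕ.+ k ℕ.* p ^ j) + x ^ᴸ E * T     ∎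
      where
      T = trace L p j (x ^ᴸ k)

  traceMoment≈∑x^N : E ℕ.+ k ≡ N → ∀ j → (∀ i → 1 ≤ i → i < suc j → N ∤ E ℕ.+ k ℕ.* p ^ i) →
                     traceMoment (suc j) ≈ ∑ (_^ᴸ N)
  traceMoment≈∑x^N E+k≡N zero _ = begin
    traceMoment 1                            ≈⟨ traceMoment-suc 0 ⟩
    ∑ (_^ᴸ (E ℕ.+ k ℕ.* 1)) + traceMoment 0  ≈⟨ +-cong (reflexive (cong (λ n → ∑ (_^ᴸ n)) E+k*1≡N)) traceMoment-zero ⟩
    ∑ (_^ᴸ N) + 0#                           ≈⟨ +-identityʳ _ ⟩
    ∑ (_^ᴸ N)                                ∎
    where
    E+k*1≡N : E ℕ.+ k ℕ.* 1 ≡ N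
    E+k*1≡N = ≡.trans (cong (E ℕ.+_) (ℕ.*-identityʳ k)) E+k≡N
  traceMoment≈∑x^N E+k≡N (suc j) N∤E+kpⁱ = begin
    traceMoment (suc (suc j))                               ≈⟨ traceMoment-suc (suc j) ⟩
    ∑ (_^ᴸ (E ℕ.+ k ℕ.* p ^ suc j)) + traceMoment (suc j)  ≈⟨ +-cong (∑x^e≈0 (N∤E+kpⁱ (suc j) (s≤s z≤n) ℕ.≤-refl)) IH ⟩
    0# + ∑ (_^ᴸ N)                                          ≈⟨ +-identityˡ _ ⟩
    ∑ (_^ᴸ N)                                               ∎
    where
    IH : traceMoment (suc j) ≈ ∑ (_^ᴸ N)
    IH = traceMoment≈∑x^N E+k≡N j (λ i 1≤i i<1+j → N∤E+kpⁱ i 1≤i (ℕ.m<n⇒m<1+n i<1+j))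

  ZeroOrTraceOfOne : ℕ → Carrier → Set ℓ′
  ZeroOrTraceOfOne ℓ x = x ≈ 0# ⊎ trace L p ℓ (x ^ᴸ k) ≈ trace L p ℓ 1#

  zeroOrTraceOfOne? : ∀ ℓ x → Dec (ZeroOrTraceOfOne ℓ x)
  zeroOrTraceOfOne? ℓ x = x ≈? 0# ⊎-dec trace L p ℓ (x ^ᴸ k) ≈? trace L p ℓ 1#

  traceMoment≈0 : ∀ ℓ → N ∤ E → (∀ i → ZeroOrTraceOfOne ℓ (from i)) → traceMoment ℓ ≈ 0#
  traceMoment≈0 ℓ N∤E zero-or-trace-of-one = begin
    traceMoment ℓ                      ≈⟨ sum-cong-≋ term ⟩
    ∑ (λ x → trace L p ℓ 1# * x ^ᴸ E)  ≈⟨ sym (*-distribˡ-sum (trace L p ℓ 1#) (λ i → from i ^ᴸ E)) ⟩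
    trace L p ℓ 1# * ∑ (_^ᴸ E)         ≈⟨ *-congˡ (∑x^e≈0 N∤E) ⟩
    trace L p ℓ 1# * 0#                ≈⟨ zeroʳ _ ⟩
    0#                                 ∎
    where
    instance
      E≢0 : NonZero E
      E≢0 = ≢-nonZero λ E≡0 → N∤E (subst (N ∣_) (≡.sym E≡0) (N ∣0))
    term : ∀ i → from i ^ᴸ E * trace L p ℓ (from i ^ᴸ k) ≈ trace L p ℓ 1# * from i ^ᴸ E
    term i with zero-or-trace-of-one i
    ... | inj₁ x≈0 = let x^E≈0 = trans (^-congˡ E x≈0) (0^ᴸn≈0 E) in
      trans (trans (*-congʳ x^E≈0) (zeroˡ _)) (sym (trans (*-congˡ x^E≈0) (zeroʳ _)))
    ... | inj₂ tr[x^k]≈tr1 = trans (*-congˡ tr[x^k]≈tr1) (*-comm _ _)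

  trace-nonconstant : ∀ ℓ → 1 ≤ ℓ → E ℕ.+ k ≡ N → N ∤ E → (∀ j → 1 ≤ j → j < ℓ → N ∤ E ℕ.+ k ℕ.* p ^ j) →
                      ∃ λ x → x ≉ 0# × trace L p ℓ (x ^ᴸ k) ≉ trace L p ℓ 1#
  trace-nonconstant (suc j) _ E+k≡N N∤E N∤E+kpʲ with all? (zeroOrTraceOfOne? (suc j) ∘ from)
  ... | yes zero-or-trace-of-one = contradiction (begin
    - 1#                 ≈⟨ sym ∑x^N≈-1 ⟩
    ∑ (_^ᴸ N)            ≈⟨ sym (traceMoment≈∑x^N E+k≡N j N∤E+kpʲ) ⟩
    traceMoment (suc j)  ≈⟨ traceMoment≈0 (suc j) N∤E zero-or-trace-of-one ⟩
    0#                   ∎) -1≉0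
  ... | no ¬zero-or-trace-of-one =
    let i , ¬[zero-or-trace-of-one] = ¬∀⟶∃¬ _ _ (zeroOrTraceOfOne? (suc j) ∘ from) ¬zero-or-trace-of-one
    in from i , ¬[zero-or-trace-of-one] ∘ inj₁ , ¬[zero-or-trace-of-one] ∘ inj₂

lemma5p4 : ∀ {c ℓ' : Level} (p m ℓ : ℕ) → Prime p → 3 ≤ m
  → gcd p m ≡ 1 → gcd (p ∸ 1) m ≡ 1
  → 1 ≤ ℓ → 1 < gcd (p ^ ℓ ∸ 1) m
  → (∀ e → 1 ≤ e → e < ℓ → ¬ (1 < gcd (p ^ e ∸ 1) m))
  → (L : CommutativeRing c ℓ') → IsField L → HasSize L (p ^ ℓ)
  → let open CommutativeRing L
        m′ = gcd (p ^ ℓ ∸ 1) m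
    in ∃₂ λ h₁ h₂ → (pow L h₁ m′ ≈ 1#) × (pow L h₂ m′ ≈ 1#)
                    × ¬ (trace L p ℓ h₁ ≈ trace L p ℓ h₂)
lemma5p4 p m ℓ p-prime 3≤m _ _ 1≤ℓ 1<m′ below-order L isField size =
  let x , x≉0 , tr[x^k]≉tr1 = trace-nonconstant ℓ 1≤ℓ (k*pred[m]+k≡k*m k m′) (k*m∤k*pred[m] k 1<m′)
                                (λ j 1≤j j<ℓ → m′∤pred[p^j] j 1≤j j<ℓ ∘ k*m∣k*pred[m]+k*n⇒m∣pred[n] k (p ^ j))
  in 1# , x ^ᴸ k
   , trans (reflexive (pow≡^ᴸ 1# m′)) (1^ᴸn≈1 m′)
   , trans (reflexive (pow≡^ᴸ (x ^ᴸ k) m′)) (trans (^-assocʳ x k m′) (fermat x≉0))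
   , tr[x^k]≉tr1 ∘ sym
  where
  open CommutativeRing L hiding (zero)
  open FieldProperties L isField
  m′ : ℕ
  m′ = gcd (p ^ ℓ ∸ 1) m
  k : ℕ
  k = _∣_.quotient (gcd[m,n]∣m (p ^ ℓ ∸ 1) m)
  1<p^ℓ : 1 < p ^ ℓ
  1<p^ℓ = ℕ.^-monoʳ-< p (nonTrivial⇒n>1 p {{prime⇒nonTrivial p-prime}}) 1≤ℓ
  p^ℓ≡1+k*m′ : p ^ ℓ ≡ suc (k ℕ.* m′)
  p^ℓ≡1+k*m′ = ≡.trans (≡.sym (ℕ.suc-pred (p ^ ℓ) {{>-nonZero (ℕ.<⇒≤ 1<p^ℓ)}})) (cong suc (_∣_.equality (gcd[m,n]∣m _ m)))
  instance
    k*m′≢0 : NonZero (k ℕ.* m′)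
    k*m′≢0 = >-nonZero (ℕ.≤-pred (subst (1 <_) p^ℓ≡1+k*m′ 1<p^ℓ))
    k≢0 : NonZero k
    k≢0 = ℕ.m*n≢0⇒m≢0 k
    m′≢0 : NonZero m′
    m′≢0 = ℕ.m*n≢0⇒n≢0 k
    m≢0 : NonZero m
    m≢0 = >-nonZero (ℕ.<-≤-trans (s≤s z≤n) 3≤m)
  size′ : HasSize L (suc (k ℕ.* m′))
  size′ = subst (HasSize L) p^ℓ≡1+k*m′ size
  open FiniteField L isField size′ using (fermat)
  open TraceOfPowers L isField size′ p k (k ℕ.* pred m′) using (trace-nonconstant)
  m′∤pred[p^j] : ∀ j → 1 ≤ j → j < ℓ → m′ ∤ pred (p ^ j)
  m′∤pred[p^j] = below-order⇒∤pred[p^j] (gcd[m,n]∣n (p ^ ℓ ∸ 1) m) 1<m′ below-order
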